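{- If a reduced graph contains an even hole of length at least eight, then it is bipartite.
   Context: A hole is an induced cycle of length at least four; it is even if its length is even. $C_\ell$ is the cycle on $\ell$ vertices, $C_\ell^*$ is $C_\ell$ plus an isolated vertex, and $\overline{H}$ is the complement of $H$. $S_3$ (tent): triangle $a_1a_2a_3$ plus $b_1,b_2,b_3$ with $b_i$ adjacent exactly to $a_i,a_{i+1}$ (indices mod 3); $S_3^*$ is $S_3$ plus an isolated vertex. $F_1$ (long claw): a vertex with three pendant paths each of length $2$. $F_2$: a 4-cycle $x_1x_2x_3x_4$ with three further vertices, pendant at $x_1$, $x_2$, $x_3$ respectively. $F_3$: a 6-cycle $y_1\cdots y_6$ with chord $y_1y_4$, plus a pendant vertex adjacent only to $y_1$. $F_4$: the same 6-cycle with chord $y_1y_4$, plus a vertex adjacent exactly to $y_1$ and $y_4$. A graph is reduced if it is connected, its complement is connected, and it contains no induced subgraph isomorphic to $C_3^*$, $C_5^*$, $\overline{C_4^*}$, $C_6$, $S_3$, $\overline{S_3^*}$, $F_1$, $F_2$, $F_3$, or $F_4$. -}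

module Defs where

open import Data.Nat using (ℕ; zero; suc; pred; _%_; _≡ᵇ_; _≤_)
open import Data.Nat.Divisibility using (_∣_)
open import Data.Fin using (Fin; toℕ)
open import Data.Bool using (Bool; true; false; _∧_; _∨_; not)
open import Data.List using (List; []; _∷_)
open import Data.Bool.ListAction using (any)
open import Data.Product using (Σ; _×_; _,_; ∃-syntax)
open import Function.Definitions using (Injective)
open import Relation.Binary.PropositionalEquality using (_≡_)
open import Relation.Nullary using (¬_)

record Graph (n : ℕ) : Set where
  field
    adj    : Fin n → Fin n → Bool
    sym    : ∀ u v → adj u v ≡ adj v u
    irrefl : ∀ u → adj u u ≡ false
open Graph public

Pattern : ℕ → Set
Pattern k = Fin k → Fin k → Bool

fromEdges : (k : ℕ) → List (ℕ × ℕ) → Pattern k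
fromEdges k es i j = any (λ { (a , b) →
  ((a ≡ᵇ toℕ i) ∧ (b ≡ᵇ toℕ j)) ∨ ((a ≡ᵇ toℕ j) ∧ (b ≡ᵇ toℕ i)) }) es

coPattern : ∀ {k} → Pattern k → Pattern k
coPattern H i j = not (H i j) ∧ not (toℕ i ≡ᵇ toℕ j)

cyclePat : (ℓ : ℕ) → Pattern ℓ
cyclePat ℓ i j = ((suc (toℕ i) % suc ℓ') ≡ᵇ toℕ j) ∨ ((suc (toℕ j) % suc ℓ') ≡ᵇ toℕ i)
  where
  ℓ' : ℕ
  ℓ' = pred ℓ

ContainsInduced : ∀ {n k} → Graph n → Pattern k → Set
ContainsInduced {n} {k} G H =
  Σ (Fin k → Fin n) λ f → Injective _≡_ _≡_ f × (∀ i j → adj G (f i) (f j) ≡ H i j)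

complement : ∀ {n} → Graph n → Graph n
complement {n} G = record
  { adj = λ u v → not (adj G u v) ∧ not (toℕ u ≡ᵇ toℕ v)
  ; sym = λ u v → symc u v
  ; irrefl = λ u → irr u }
  where
  open import Relation.Binary.PropositionalEquality using (cong₂; cong; refl)
  open import Data.Nat.Properties using (≡ᵇ⇒≡; ≡⇒≡ᵇ)
  symEq : ∀ (a b : ℕ) → (a ≡ᵇ b) ≡ (b ≡ᵇ a)
  symEq zero zero = refl
  symEq zero (suc b) = refl
  symEq (suc a) zero = refl
  symEq (suc a) (suc b) = symEq a b
  symc : ∀ u v → (not (adj G u v) ∧ not (toℕ u ≡ᵇ toℕ v)) ≡ (not (adj G v u) ∧ not (toℕ v ≡ᵇ toℕ u))
  symc u v = cong₂ (λ x y → not x ∧ not y) (Graph.sym G u v) (symEq (toℕ u) (toℕ v))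
  reflEq : ∀ (a : ℕ) → (a ≡ᵇ a) ≡ true
  reflEq zero = refl
  reflEq (suc a) = reflEq a
  irr : ∀ u → (not (adj G u u) ∧ not (toℕ u ≡ᵇ toℕ u)) ≡ false
  irr u rewrite reflEq (toℕ u) with adj G u u
  ... | true = refl
  ... | false = refl

data Reachable {n} (G : Graph n) : Fin n → Fin n → Set where
  here : ∀ {u} → Reachable G u u
  step : ∀ {u w v} → adj G u w ≡ true → Reachable G w v → Reachable G u v

Connected : ∀ {n} → Graph n → Set
Connected {n} G = ∀ (u v : Fin n) → Reachable G u v

Bipartite : ∀ {n} → Graph n → Set
Bipartite {n} G = Σ (Fin n → Bool) λ c → ∀ u v → adj G u v ≡ true → ¬ (c u ≡ c v)

C3* : Pattern 4
C3* = fromEdges 4 ((0 , 1) ∷ (1 , 2) ∷ (2 , 0) ∷ [])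

C5* : Pattern 6
C5* = fromEdges 6 ((0 , 1) ∷ (1 , 2) ∷ (2 , 3) ∷ (3 , 4) ∷ (4 , 0) ∷ [])

C4* : Pattern 5
C4* = fromEdges 5 ((0 , 1) ∷ (1 , 2) ∷ (2 , 3) ∷ (3 , 0) ∷ [])

coC4* : Pattern 5
coC4* = coPattern C4*

C6 : Pattern 6
C6 = cyclePat 6

-- tent: a1,a2,a3 = 0,1,2 ; b1,b2,b3 = 3,4,5
S3edges : List (ℕ × ℕ)
S3edges = (0 , 1) ∷ (1 , 2) ∷ (2 , 0) ∷ (3 , 0) ∷ (3 , 1) ∷ (4 , 1) ∷ (4 , 2) ∷ (5 , 2) ∷ (5 , 0) ∷ []

S3 : Pattern 6
S3 = fromEdges 6 S3edges

S3* : Pattern 7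
S3* = fromEdges 7 S3edges

coS3* : Pattern 7
coS3* = coPattern S3*

-- long claw: centre 0, paths 0-1-2, 0-3-4, 0-5-6
F1 : Pattern 7
F1 = fromEdges 7 ((0 , 1) ∷ (1 , 2) ∷ (0 , 3) ∷ (3 , 4) ∷ (0 , 5) ∷ (5 , 6) ∷ [])

-- x1..x4 = 0..3 ; pendants 4,5,6 at x1,x2,x3
F2 : Pattern 7
F2 = fromEdges 7 ((0 , 1) ∷ (1 , 2) ∷ (2 , 3) ∷ (3 , 0) ∷ (4 , 0) ∷ (5 , 1) ∷ (6 , 2) ∷ [])

-- y1..y6 = 0..5, chord y1y4 = 0-3
C6chord : List (ℕ × ℕ)
C6chord = (0 , 1) ∷ (1 , 2) ∷ (2 , 3) ∷ (3 , 4) ∷ (4 , 5) ∷ (5 , 0) ∷ (0 , 3) ∷ []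

F3 : Pattern 7
F3 = fromEdges 7 ((6 , 0) ∷ C6chord)

F4 : Pattern 7
F4 = fromEdges 7 ((6 , 0) ∷ (6 , 3) ∷ C6chord)

Reduced : ∀ {n} → Graph n → Set
Reduced G =
  Connected G × Connected (complement G) ×
  ¬ ContainsInduced G C3* × ¬ ContainsInduced G C5* × ¬ ContainsInduced G coC4* ×
  ¬ ContainsInduced G C6 × ¬ ContainsInduced G S3 × ¬ ContainsInduced G coS3* ×
  ¬ ContainsInduced G F1 × ¬ ContainsInduced G F2 × ¬ ContainsInduced G F3 ×
  ¬ ContainsInduced G F4

HasHole : ∀ {n} → Graph n → ℕ → Set
HasHole G ℓ = 4 ≤ ℓ × ContainsInduced G (cyclePat ℓ)

HasEvenHoleAtLeast8 : ∀ {n} → Graph n → Set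
HasEvenHoleAtLeast8 G = ∃[ ℓ ] (8 ≤ ℓ × 2 ∣ ℓ × HasHole G ℓ)

-- Number the vertices of the even hole h₀ … h_{ℓ-1} cyclically. The excluded graphs
-- C₃*, co-C₄*, C₅*, F₁ and F₂ pin down how a vertex v can see the hole: never two
-- consecutive hole vertices, and if v sees h_b and h_{b+2} then only hole vertices at even
-- distance from h_b; otherwise it sees a single one. So the hole neighbours of v all have
-- positions of one parity. Two adjacent vertices cannot have hole neighbours of the same
-- parity, and a vertex seeing the hole has no neighbour missing it, since either situation
-- produces one of these graphs around the hole. By connectivity every vertex sees the
-- hole, and colouring each vertex by the parity of the position of one of its hole
-- neighbours is a proper 2-colouring; parity is well defined mod ℓ because ℓ is even.

module Submission where

open import Defs hiding (sym; irrefl)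
open import Data.Bool using (Bool; true; false; T)
open import Data.Bool.Properties using (not-¬; ¬-not; T-∨; T-≡) renaming (_≟_ to _≟ᵇ_)
open import Data.Empty using (⊥; ⊥-elim)
open import Data.Fin using (Fin; toℕ) renaming (zero to fzero; suc to fsuc; _<_ to _<ᶠ_)
open import Data.Fin.Properties using (all?; any?; <-cmp; toℕ-fromℕ<; fromℕ<-cong; toℕ<n)
  renaming (_≟_ to _≟ᶠ_)
open import Data.List using (List; _∷_; [])
open import Data.List.Relation.Unary.All as All using (All; _∷_; [])
open import Data.Nat using (ℕ; zero; suc; _+_; _*_; _∸_; _≤_; _<_; _≤?_; _%_; _/_; _≡ᵇ_; parity; NonZero; s≤s)
open import Data.Nat.DivMod
  using (_mod_; m≡m%n+[m/n]*n; m%n%n≡m%n; [m+n]%n≡m%n; m<n⇒m%n≡m; m%n<n; %-distribˡ-+)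
open import Data.Nat.Divisibility using (_∣_; divides)
open import Data.Nat.Properties
  using (+-comm; +-assoc; +-identityʳ; m≤m+n; m∸n+n≡m; n<1+n; <-trans; <⇒≤; <⇒≢; ≤-trans; ≡ᵇ⇒≡; ≡⇒≡ᵇ)
open import Data.Parity using (Parity; 0ℙ; 1ℙ) renaming (_+_ to _ℙ+_; _*_ to _ℙ*_)
open import Data.Parity.Properties as ℙ using ()
open import Data.Product using (∃; _×_; _,_; proj₁; proj₂)
open import Data.Sum using (_⊎_; inj₁; inj₂) renaming (map to ⊎-map)
open import Data.Unit using (⊤; tt)
open import Data.Vec using (Vec; _∷_; []; lookup)
open import Function using (_∘_; Equivalence)
open import Relation.Binary using (Setoid; IsEquivalence; tri<; tri≈; tri>)
open import Relation.Binary.PropositionalEquality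
  using (_≡_; _≢_; refl; sym; trans; cong; subst; module ≡-Reasoning)
import Relation.Binary.Reasoning.Setoid
open import Relation.Nullary using (¬_; Dec; yes; no)
open import Relation.Nullary.Decidable using (True; toWitness; map′; _⊎-dec_; ¬?)

AllFin : ∀ k → (Fin k → Set) → Set
AllFin zero    P = ⊤
AllFin (suc k) P = P fzero × AllFin k (P ∘ fsuc)

UpperTriangle : ∀ k → (Fin k → Fin k → Set) → Set
UpperTriangle zero          R = ⊤
UpperTriangle (suc zero)    R = ⊤
UpperTriangle (suc (suc k)) R =
  AllFin (suc k) (R fzero ∘ fsuc) × UpperTriangle (suc k) (λ i j → R (fsuc i) (fsuc j))

allFin-lookup : ∀ {k P} → AllFin k P → ∀ i → P i
allFin-lookup (p , _)  fzero    = p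
allFin-lookup (_ , ps) (fsuc i) = allFin-lookup ps i

upperTriangle-lookup : ∀ {k R} → UpperTriangle k R → ∀ {i j} → i <ᶠ j → R i j
upperTriangle-lookup {suc (suc k)} {R} (row , _)   {fzero}  {fsuc j} _       = allFin-lookup {P = R fzero ∘ fsuc} row j
upperTriangle-lookup {suc (suc k)}     (_ , rest) {fsuc i} {fsuc j} (s≤s i<j) = upperTriangle-lookup rest i<j

PatternSymmetric : ∀ {k} → Pattern k → Set
PatternSymmetric P = ∀ i j → P i j ≡ P j i

PatternLoopless : ∀ {k} → Pattern k → Set
PatternLoopless P = ∀ i → P i i ≡ false

-- Without twins, a map reflecting the pattern's adjacency is automatically injective.
PatternTwinFree : ∀ {k} → Pattern k → Set
PatternTwinFree P = ∀ i j → i ≡ j ⊎ ∃ λ x → P i x ≢ P j x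

patternSymmetric? : ∀ {k} (P : Pattern k) → Dec (PatternSymmetric P)
patternSymmetric? P = all? λ i → all? λ j → P i j ≟ᵇ P j i

patternLoopless? : ∀ {k} (P : Pattern k) → Dec (PatternLoopless P)
patternLoopless? P = all? λ i → P i i ≟ᵇ false

patternTwinFree? : ∀ {k} (P : Pattern k) → Dec (PatternTwinFree P)
patternTwinFree? P = all? λ i → all? λ j → (i ≟ᶠ j) ⊎-dec any? (λ x → ¬? (P i x ≟ᵇ P j x))

induced-copy :
  ∀ {n k} (G : Graph n) (P : Pattern k)
  {_ : True (patternSymmetric? P)} {_ : True (patternLoopless? P)} {_ : True (patternTwinFree? P)}
  (vs : Vec (Fin n) k) → UpperTriangle k (λ i j → adj G (lookup vs i) (lookup vs j) ≡ P i j) →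
  ContainsInduced G P
induced-copy {n} {k} G P {sym?} {loopless?} {twinFree?} vs upper = g , injective , agrees
  where
  g : Fin k → Fin n
  g = lookup vs
  agrees : ∀ i j → adj G (g i) (g j) ≡ P i j
  agrees i j with <-cmp i j
  ... | tri< i<j _ _ = upperTriangle-lookup upper i<j
  ... | tri> _ _ j<i = trans (Graph.sym G (g i) (g j))
                         (trans (upperTriangle-lookup upper j<i) (toWitness sym? j i))
  ... | tri≈ _ refl _ = trans (Graph.irrefl G (g i)) (sym (toWitness loopless? i))
  injective : ∀ {i j} → g i ≡ g j → i ≡ j
  injective {i} {j} gi≡gj with toWitness twinFree? i j
  ... | inj₁ i≡j = i≡j
  ... | inj₂ (x , differ) =
    ⊥-elim (differ (trans (sym (agrees i x)) (trans (cong (λ v → adj G v (g x)) gi≡gj) (agrees j x))))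

isOdd : Parity → Bool
isOdd 0ℙ = false
isOdd 1ℙ = true

isOdd-injective : ∀ {p q} → isOdd p ≡ isOdd q → p ≡ q
isOdd-injective {0ℙ} {0ℙ} _ = refl
isOdd-injective {1ℙ} {1ℙ} _ = refl

even⇒parity≡0ℙ : ∀ {m} → 2 ∣ m → parity m ≡ 0ℙ
even⇒parity≡0ℙ (divides q refl) = trans (ℙ.*-homo-* q 2) (ℙ.*-zeroʳ (parity q))

parity-suc≢ : ∀ m → parity m ≢ parity (suc m)
parity-suc≢ m m≡1+m = ℙ.p≢p⁻¹ (parity (suc m)) (trans (sym m≡1+m) (sym (ℙ.suc-homo-⁻¹ m)))

module Modulo (ℓ : ℕ) .{{_ : NonZero ℓ}} where

  infix 4 _≈_
  record _≈_ (x y : ℕ) : Set where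
    constructor mod-eq
    field residue-eq : x % ℓ ≡ y % ℓ
  open _≈_

  ≈-isEquivalence : IsEquivalence _≈_
  ≈-isEquivalence = record
    { refl  = mod-eq refl
    ; sym   = λ x≈y → mod-eq (sym (residue-eq x≈y))
    ; trans = λ x≈y y≈z → mod-eq (trans (residue-eq x≈y) (residue-eq y≈z))
    }

  ≈-setoid : Setoid _ _
  ≈-setoid = record { isEquivalence = ≈-isEquivalence }

  open IsEquivalence ≈-isEquivalence public
    using () renaming (refl to ≈-refl; sym to ≈-sym; trans to ≈-trans; reflexive to ≡⇒≈)
  module ≈-Reasoning = Relation.Binary.Reasoning.Setoid ≈-setoid

  %-≈ : ∀ x → x % ℓ ≈ x
  %-≈ x = mod-eq (m%n%n≡m%n x ℓ)

  ℓ≈0 : ℓ ≈ 0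
  ℓ≈0 = mod-eq ([m+n]%n≡m%n 0 ℓ)

  +-congˡ : ∀ k {x y} → x ≈ y → k + x ≈ k + y
  +-congˡ k {x} {y} (mod-eq x≡y) = mod-eq (begin
    (k + x) % ℓ             ≡⟨ %-distribˡ-+ k x ℓ ⟩
    (k % ℓ + x % ℓ) % ℓ     ≡⟨ cong (λ r → (k % ℓ + r) % ℓ) x≡y ⟩
    (k % ℓ + y % ℓ) % ℓ     ≡⟨ sym (%-distribˡ-+ k y ℓ) ⟩
    (k + y) % ℓ             ∎)
    where open ≡-Reasoning

  +-congʳ : ∀ k {x y} → x ≈ y → x + k ≈ y + k
  +-congʳ k {x} {y} x≈y = begin
    x + k  ≡⟨ +-comm x k ⟩
    k + x  ≈⟨ +-congˡ k x≈y ⟩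
    k + y  ≡⟨ +-comm k y ⟩
    y + k  ∎
    where open ≈-Reasoning

  +-absorbʳ : ∀ x {z} → z ≈ 0 → x + z ≈ x
  +-absorbʳ x {z} z≈0 = begin
    x + z  ≈⟨ +-congˡ x z≈0 ⟩
    x + 0  ≡⟨ +-identityʳ x ⟩
    x      ∎
    where open ≈-Reasoning

  inverseˡ : ∀ k → (ℓ ∸ k % ℓ) + k ≈ 0
  inverseˡ k = begin
    (ℓ ∸ k % ℓ) + k      ≈⟨ +-congˡ (ℓ ∸ k % ℓ) (≈-sym (%-≈ k)) ⟩
    (ℓ ∸ k % ℓ) + k % ℓ  ≡⟨ m∸n+n≡m (<⇒≤ (m%n<n k ℓ)) ⟩
    ℓ                    ≈⟨ ℓ≈0 ⟩
    0                    ∎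
    where open ≈-Reasoning

  +-cancelʳ : ∀ k {x y} → x + k ≈ y + k → x ≈ y
  +-cancelʳ k {x} {y} x+k≈y+k = begin
    x                    ≈⟨ ≈-sym (+-absorbʳ x (inverseˡ k)) ⟩
    x + (-k + k)         ≡⟨ cong (x +_) (+-comm -k k) ⟩
    x + (k + -k)         ≡⟨ +-assoc x k -k ⟨
    x + k + -k           ≈⟨ +-congʳ -k x+k≈y+k ⟩
    y + k + -k           ≡⟨ +-assoc y k -k ⟩
    y + (k + -k)         ≡⟨ cong (y +_) (+-comm k -k) ⟩
    y + (-k + k)         ≈⟨ +-absorbʳ y (inverseˡ k) ⟩
    y                    ∎
    where
    open ≈-Reasoning
    -k = ℓ ∸ k % ℓ

  +-cancelˡ : ∀ k {x y} → k + x ≈ k + y → x ≈ y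
  +-cancelˡ k {x} {y} k+x≈k+y =
    +-cancelʳ k (≈-trans (≡⇒≈ (+-comm x k)) (≈-trans k+x≈k+y (≡⇒≈ (+-comm k y))))

  ≈-bounded⇒≡ : ∀ {x y} → x < ℓ → y < ℓ → x ≈ y → x ≡ y
  ≈-bounded⇒≡ x<ℓ y<ℓ (mod-eq x%≡y%) = trans (sym (m<n⇒m%n≡m x<ℓ)) (trans x%≡y% (m<n⇒m%n≡m y<ℓ))

  -- The last hypothesis excludes the wrap-around pair s = 0, t = ℓ - 1.
  non-successive : ∀ {s t} → 2 + s ≤ t → t < ℓ → 1 ≤ s ⊎ suc t < ℓ → ¬ (suc s ≈ t ⊎ suc t ≈ s)
  non-successive 2+s≤t t<ℓ _ (inj₁ s→t) =
    <⇒≢ 2+s≤t (≈-bounded⇒≡ (<-trans 2+s≤t t<ℓ) t<ℓ s→t)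
  non-successive {s} {t} 2+s≤t t<ℓ (inj₂ 1+t<ℓ) (inj₂ t→s) =
    <⇒≢ (<-trans s<t (n<1+n t)) (sym (≈-bounded⇒≡ 1+t<ℓ (<-trans s<t t<ℓ) t→s))
    where s<t = <-trans (n<1+n s) 2+s≤t
  non-successive {suc s} {t} 2+s≤t t<ℓ (inj₁ _) (inj₂ t→s) =
    <⇒≢ s<t (sym (≈-bounded⇒≡ t<ℓ (<-trans s<t t<ℓ) (+-cancelˡ 1 t→s)))
    where s<t = <-trans (n<1+n s) (<-trans (n<1+n (suc s)) 2+s≤t)

  offset : ∀ b y → ∃ λ t → t < ℓ × t + b ≈ y
  offset b y = (y + -b) % ℓ , m%n<n (y + -b) ℓ , (begin
    (y + -b) % ℓ + b  ≈⟨ +-congʳ b (%-≈ (y + -b)) ⟩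
    y + -b + b        ≡⟨ +-assoc y -b b ⟩
    y + (-b + b)      ≈⟨ +-absorbʳ y (inverseˡ b) ⟩
    y                 ∎)
    where
    open ≈-Reasoning
    -b = ℓ ∸ b % ℓ

  anchor : ∀ s x → ∃ λ b → s + b ≈ x
  anchor s x with offset s x
  ... | b , _ , b+s≈x = b , ≈-trans (≡⇒≈ (+-comm s b)) b+s≈x

  parity-cong : 2 ∣ ℓ → ∀ {x y} → x ≈ y → parity x ≡ parity y
  parity-cong 2∣ℓ {x} {y} (mod-eq x%≡y%) =
    trans (parity-residue x) (trans (cong parity x%≡y%) (sym (parity-residue y)))
    where
    open ≡-Reasoning
    ℓ-even : parity ℓ ≡ 0ℙ
    ℓ-even = even⇒parity≡0ℙ 2∣ℓ
    parity-residue : ∀ z → parity z ≡ parity (z % ℓ)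
    parity-residue z = begin
      parity z                                            ≡⟨ cong parity (m≡m%n+[m/n]*n z ℓ) ⟩
      parity (z % ℓ + z / ℓ * ℓ)                          ≡⟨ ℙ.+-homo-+ (z % ℓ) (z / ℓ * ℓ) ⟩
      parity (z % ℓ) ℙ+ parity (z / ℓ * ℓ)                ≡⟨ cong (parity (z % ℓ) ℙ+_) (ℙ.*-homo-* (z / ℓ) ℓ) ⟩
      parity (z % ℓ) ℙ+ (parity (z / ℓ) ℙ* parity ℓ)      ≡⟨ cong (λ p → parity (z % ℓ) ℙ+ (parity (z / ℓ) ℙ* p)) ℓ-even ⟩
      parity (z % ℓ) ℙ+ (parity (z / ℓ) ℙ* 0ℙ)            ≡⟨ cong (parity (z % ℓ) ℙ+_) (ℙ.*-zeroʳ (parity (z / ℓ))) ⟩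
      parity (z % ℓ) ℙ+ 0ℙ                                ≡⟨ ℙ.+-identityʳ (parity (z % ℓ)) ⟩
      parity (z % ℓ)                                      ∎

  toℕ-mod : ∀ x → toℕ (x mod ℓ) ≈ x
  toℕ-mod x = ≈-trans (≡⇒≈ (toℕ-fromℕ< (m%n<n x ℓ))) (%-≈ x)

module Adjacency {n} (G : Graph n) where

  infix 4 _~_ _≁_
  _~_ _≁_ : Fin n → Fin n → Set
  u ~ v = adj G u v ≡ true
  u ≁ v = adj G u v ≡ false

  ~-sym : ∀ {u v} → u ~ v → v ~ u
  ~-sym {u} {v} = trans (Graph.sym G v u)

  ≁-sym : ∀ {u v} → u ≁ v → v ≁ u
  ≁-sym {u} {v} = trans (Graph.sym G v u)

  ¬~⇒≁ : ∀ {u v} → ¬ u ~ v → u ≁ v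
  ¬~⇒≁ = ¬-not

  ~⇒¬≁ : ∀ {u v} → u ~ v → ¬ u ≁ v
  ~⇒¬≁ u~v u≁v = not-¬ u~v u≁v

-- A hole of length ℓ = suc k, enumerated periodically by ℕ so that hole positions
-- can be shifted freely.
module Hole {n} (G : Graph n) (k : ℕ) (f : Fin (suc k) → Fin n)
            (f-adj : ∀ i j → adj G (f i) (f j) ≡ cyclePat (suc k) i j) where

  ℓ : ℕ
  ℓ = suc k

  open Modulo ℓ public
  open Adjacency G

  ≡ᵇ-residue⇒≈ : ∀ x (j : Fin ℓ) → T (x % ℓ ≡ᵇ toℕ j) → x ≈ toℕ j
  ≡ᵇ-residue⇒≈ x j x%≡j = mod-eq (trans (≡ᵇ⇒≡ _ _ x%≡j) (sym (m<n⇒m%n≡m (toℕ<n j))))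

  cyclePat-true⇒ : ∀ i j → cyclePat ℓ i j ≡ true → suc (toℕ i) ≈ toℕ j ⊎ suc (toℕ j) ≈ toℕ i
  cyclePat-true⇒ i j i~j with Equivalence.to T-∨ (Equivalence.from T-≡ i~j)
  ... | inj₁ i→j = inj₁ (≡ᵇ-residue⇒≈ _ j i→j)
  ... | inj₂ j→i = inj₂ (≡ᵇ-residue⇒≈ _ i j→i)

  successor⇒cyclePat : ∀ i j → suc (toℕ i) ≈ toℕ j → cyclePat ℓ i j ≡ true
  successor⇒cyclePat i j (mod-eq i→j) =
    Equivalence.to T-≡ (Equivalence.from T-∨ (inj₁ (≡⇒≡ᵇ _ _ (trans i→j (m<n⇒m%n≡m (toℕ<n j))))))

  -- Opaque, so that a position x can be inferred from a type mentioning hole x.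
  opaque
    hole : ℕ → Fin n
    hole x = f (x mod ℓ)

    hole-cong : ∀ {x y} → x ≈ y → hole x ≡ hole y
    hole-cong {x} {y} (mod-eq x%≡y%) = cong f (fromℕ<-cong _ _ x%≡y% (m%n<n x ℓ) (m%n<n y ℓ))

    hole-suc : ∀ x → hole x ~ hole (suc x)
    hole-suc x = trans (f-adj _ _) (successor⇒cyclePat _ _ (begin
      suc (toℕ (x mod ℓ))  ≈⟨ +-congˡ 1 (toℕ-mod x) ⟩
      suc x                ≈⟨ toℕ-mod (suc x) ⟨
      toℕ (suc x mod ℓ)    ∎))
      where open ≈-Reasoning

    hole-adjacent : ∀ x y → hole x ~ hole y → suc x ≈ y ⊎ suc y ≈ x
    hole-adjacent x y x~y with cyclePat-true⇒ _ _ (trans (sym (f-adj _ _)) x~y)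
    ... | inj₁ x→y = inj₁ (≈-trans (+-congˡ 1 (≈-sym (toℕ-mod x))) (≈-trans x→y (toℕ-mod y)))
    ... | inj₂ y→x = inj₂ (≈-trans (+-congˡ 1 (≈-sym (toℕ-mod y))) (≈-trans y→x (toℕ-mod x)))

  ~hole-resp : ∀ {v x y} → x ≈ y → v ~ hole x → v ~ hole y
  ~hole-resp x≈y = subst (λ u → _ ~ u) (hole-cong x≈y)

  hole-nonadjacent : ∀ b {s t} → 2 + s ≤ t → t < ℓ → 1 ≤ s ⊎ suc t < ℓ → hole (s + b) ≁ hole (t + b)
  hole-nonadjacent b 2+s≤t t<ℓ no-wrap = ¬~⇒≁ λ s~t →
    non-successive 2+s≤t t<ℓ no-wrap (⊎-map (+-cancelʳ b) (+-cancelʳ b) (hole-adjacent _ _ s~t))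

module HoleNeighbourhoods
  {n} (G : Graph n) (k : ℕ) (f : Fin (suc k) → Fin n)
  (f-adj : ∀ i j → adj G (f i) (f j) ≡ cyclePat (suc k) i j) (8≤ℓ : 8 ≤ suc k) (2∣ℓ : 2 ∣ suc k)
  (C3*-free : ¬ ContainsInduced G C3*) (C5*-free : ¬ ContainsInduced G C5*)
  (coC4*-free : ¬ ContainsInduced G coC4*) (F1-free : ¬ ContainsInduced G F1)
  (F2-free : ¬ ContainsInduced G F2)
  where

  open Adjacency G
  open Hole G k f f-adj

  Misses : Fin n → ℕ → List ℕ → Set
  Misses w b positions = All (λ s → w ≁ hole (s + b)) positions

  -- Positions b, …, b + 6 induce a path in the hole; this is where ℓ ≥ 8 is used.
  hole-gap : ∀ b s t {_ : True (2 + s ≤? t)} {_ : True (t ≤? 6)} → hole (s + b) ≁ hole (t + b)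
  hole-gap b s t {2+s≤t} {t≤6} =
    hole-nonadjacent b (toWitness 2+s≤t) (<-trans (n<1+n t) 1+t<ℓ) (inj₂ 1+t<ℓ)
    where
    1+t<ℓ : suc t < ℓ
    1+t<ℓ = ≤-trans (s≤s (s≤s (toWitness t≤6))) 8≤ℓ

  hole-far : ∀ b {t} → 7 ≤ t → t < ℓ → ∀ s {_ : True (1 ≤? s)} {_ : True (s ≤? 5)} → hole (t + b) ≁ hole (s + b)
  hole-far b 7≤t t<ℓ s {1≤s} {s≤5} =
    ≁-sym (hole-nonadjacent b (≤-trans (s≤s (s≤s (toWitness s≤5))) 7≤t) t<ℓ (inj₁ (toWitness 1≤s)))

  no-consecutive-neighbours : ∀ b v → v ~ hole b → v ~ hole (1 + b) → ⊥
  no-consecutive-neighbours b v v~0 v~1 with adj G v (hole (3 + b)) in v-3 | adj G v (hole (4 + b)) in v-4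
  ... | false | _ = C3*-free (induced-copy G C3* (v ∷ hole b ∷ hole (1 + b) ∷ hole (3 + b) ∷ [])
        ((v~0 , v~1 , v-3 , tt) , (hole-suc b , hole-gap b 0 3 , tt) , (hole-gap b 1 3 , tt) , tt))
  ... | true | false = C3*-free (induced-copy G C3* (v ∷ hole b ∷ hole (1 + b) ∷ hole (4 + b) ∷ [])
        ((v~0 , v~1 , v-4 , tt) , (hole-suc b , hole-gap b 0 4 , tt) , (hole-gap b 1 4 , tt) , tt))
  ... | true | true = coC4*-free (induced-copy G coC4* (hole b ∷ hole (3 + b) ∷ hole (1 + b) ∷ hole (4 + b) ∷ v ∷ [])
        ((hole-gap b 0 3 , hole-suc b , hole-gap b 0 4 , ~-sym v~0 , tt) ,
         (≁-sym (hole-gap b 1 3) , hole-suc (3 + b) , ~-sym v-3 , tt) ,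
         (hole-gap b 1 4 , ~-sym v~1 , tt) ,
         (~-sym v-4 , tt) , tt))

  ~⇒next-≁ : ∀ b v → v ~ hole b → v ≁ hole (1 + b)
  ~⇒next-≁ b v v~0 = ¬~⇒≁ (no-consecutive-neighbours b v v~0)

  ~⇒prev-≁ : ∀ b v → v ~ hole (1 + b) → v ≁ hole b
  ~⇒prev-≁ b v v~1 = ¬~⇒≁ λ v~0 → no-consecutive-neighbours b v v~0 v~1

  no-gap-of-two : ∀ b v → v ~ hole b → v ~ hole (3 + b) → Misses v b (1 ∷ 2 ∷ []) → ⊥
  no-gap-of-two b v v~0 v~3 (v-1 ∷ v-2 ∷ []) with adj G v (hole (5 + b)) in v-5 | adj G v (hole (6 + b)) in v-6
  ... | false | _ = C5*-free (induced-copy G C5* (v ∷ hole b ∷ hole (1 + b) ∷ hole (2 + b) ∷ hole (3 + b) ∷ hole (5 + b) ∷ [])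
        ((v~0 , v-1 , v-2 , v~3 , v-5 , tt) ,
         (hole-suc b , hole-gap b 0 2 , hole-gap b 0 3 , hole-gap b 0 5 , tt) ,
         (hole-suc (1 + b) , hole-gap b 1 3 , hole-gap b 1 5 , tt) ,
         (hole-suc (2 + b) , hole-gap b 2 5 , tt) ,
         (hole-gap b 3 5 , tt) , tt))
  ... | true | false = C5*-free (induced-copy G C5* (v ∷ hole b ∷ hole (1 + b) ∷ hole (2 + b) ∷ hole (3 + b) ∷ hole (6 + b) ∷ [])
        ((v~0 , v-1 , v-2 , v~3 , v-6 , tt) ,
         (hole-suc b , hole-gap b 0 2 , hole-gap b 0 3 , hole-gap b 0 6 , tt) ,
         (hole-suc (1 + b) , hole-gap b 1 3 , hole-gap b 1 6 , tt) ,
         (hole-suc (2 + b) , hole-gap b 2 6 , tt) ,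
         (hole-gap b 3 6 , tt) , tt))
  ... | true | true = no-consecutive-neighbours (5 + b) v v-5 v-6

  no-long-claw : ∀ b v w → v ~ hole (3 + b) → Misses v b (1 ∷ 2 ∷ 4 ∷ 5 ∷ []) →
                 v ~ w → Misses w b (1 ∷ 2 ∷ 3 ∷ 4 ∷ 5 ∷ []) → ⊥
  no-long-claw b v w v~3 (v-1 ∷ v-2 ∷ v-4 ∷ v-5 ∷ []) v~w (w-1 ∷ w-2 ∷ w-3 ∷ w-4 ∷ w-5 ∷ []) =
    F1-free (induced-copy G F1
      (hole (3 + b) ∷ hole (2 + b) ∷ hole (1 + b) ∷ hole (4 + b) ∷ hole (5 + b) ∷ v ∷ w ∷ [])
      ((~-sym (hole-suc (2 + b)) , ≁-sym (hole-gap b 1 3) , hole-suc (3 + b) , hole-gap b 3 5 , ~-sym v~3 , ≁-sym w-3 , tt) ,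
       (~-sym (hole-suc (1 + b)) , hole-gap b 2 4 , hole-gap b 2 5 , ≁-sym v-2 , ≁-sym w-2 , tt) ,
       (hole-gap b 1 4 , hole-gap b 1 5 , ≁-sym v-1 , ≁-sym w-1 , tt) ,
       (hole-suc (4 + b) , ≁-sym v-4 , ≁-sym w-4 , tt) ,
       (≁-sym v-5 , ≁-sym w-5 , tt) ,
       (v~w , tt) , tt))

  no-F2 : ∀ b v w → v ~ hole (1 + b) → v ~ hole (3 + b) → v ~ w → Misses w b (0 ∷ 1 ∷ 2 ∷ 3 ∷ 4 ∷ []) → ⊥
  no-F2 b v w v~1 v~3 v~w (w-0 ∷ w-1 ∷ w-2 ∷ w-3 ∷ w-4 ∷ []) =
    F2-free (induced-copy G F2
      (hole (3 + b) ∷ v ∷ hole (1 + b) ∷ hole (2 + b) ∷ hole (4 + b) ∷ w ∷ hole b ∷ [])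
      ((~-sym v~3 , ≁-sym (hole-gap b 1 3) , ~-sym (hole-suc (2 + b)) , hole-suc (3 + b) , ≁-sym w-3 , ≁-sym (hole-gap b 0 3) , tt) ,
       (v~1 , ~⇒next-≁ (1 + b) v v~1 , ~⇒next-≁ (3 + b) v v~3 , v~w , ~⇒prev-≁ b v v~1 , tt) ,
       (hole-suc (1 + b) , hole-gap b 1 4 , ≁-sym w-1 , ~-sym (hole-suc b) , tt) ,
       (hole-gap b 2 4 , ≁-sym w-2 , ≁-sym (hole-gap b 0 2) , tt) ,
       (≁-sym w-4 , ≁-sym (hole-gap b 0 4) , tt) ,
       (w-0 , tt) , tt))

  lonely-hole-neighbour : ∀ b v {y} → v ~ hole (3 + b) → Misses v b (1 ∷ 5 ∷ []) → v ~ hole y → y ≈ 3 + b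
  lonely-hole-neighbour b v {y} v~3 (v-1 ∷ v-5 ∷ []) v~y with offset b y
  ... | t , t<ℓ , t+b≈y = ≈-trans (≈-sym t+b≈y) (position t t<ℓ (~hole-resp (≈-sym t+b≈y) v~y))
    where
    v-2 : v ≁ hole (2 + b)
    v-2 = ~⇒prev-≁ (2 + b) v v~3
    v-4 : v ≁ hole (4 + b)
    v-4 = ~⇒next-≁ (3 + b) v v~3
    position : ∀ t → t < ℓ → v ~ hole (t + b) → t + b ≈ 3 + b
    position 0 _ v~0 = ⊥-elim (no-gap-of-two b v v~0 v~3 (v-1 ∷ v-2 ∷ []))
    position 1 _ v~1 = ⊥-elim (~⇒¬≁ v~1 v-1)
    position 2 _ v~2 = ⊥-elim (~⇒¬≁ v~2 v-2)
    position 3 _ _   = ≈-refl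
    position 4 _ v~4 = ⊥-elim (~⇒¬≁ v~4 v-4)
    position 5 _ v~5 = ⊥-elim (~⇒¬≁ v~5 v-5)
    position 6 _ v~6 = ⊥-elim (no-gap-of-two (3 + b) v v~3 v~6 (v-4 ∷ v-5 ∷ []))
    position t@(suc (suc (suc (suc (suc (suc (suc t′))))))) t<ℓ v~t =
      ⊥-elim (no-long-claw b v (hole (t + b)) v~3 (v-1 ∷ v-2 ∷ v-4 ∷ v-5 ∷ []) v~t
        (far 1 ∷ far 2 ∷ far 3 ∷ far 4 ∷ far 5 ∷ []))
      where far = hole-far b (m≤m+n 7 t′) t<ℓ

  spaced-neighbours-parity : ∀ b v {y} → v ~ hole (2 + b) → v ~ hole (4 + b) → v ~ hole y → parity y ≡ parity b
  spaced-neighbours-parity b v {y} v~2 v~4 v~y with offset b y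
  ... | t , t<ℓ , t+b≈y = trans (parity-cong 2∣ℓ (≈-sym t+b≈y)) (position t t<ℓ (~hole-resp (≈-sym t+b≈y) v~y))
    where
    position : ∀ t → t < ℓ → v ~ hole (t + b) → parity (t + b) ≡ parity b
    position 0 _ _   = refl
    position 1 _ v~1 = ⊥-elim (no-consecutive-neighbours (1 + b) v v~1 v~2)
    position 2 _ _   = refl
    position 3 _ v~3 = ⊥-elim (no-consecutive-neighbours (2 + b) v v~2 v~3)
    position 4 _ _   = refl
    position 5 _ v~5 = ⊥-elim (no-consecutive-neighbours (4 + b) v v~4 v~5)
    position 6 _ _   = refl
    position t@(suc (suc (suc (suc (suc (suc (suc t′))))))) t<ℓ v~t =
      ⊥-elim (no-F2 (1 + b) v (hole (t + b)) v~2 v~4 v~t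
        (far 1 ∷ far 2 ∷ far 3 ∷ far 4 ∷ far 5 ∷ []))
      where far = hole-far b (m≤m+n 7 t′) t<ℓ

  hole-neighbours-parity≡ : ∀ v {x y} → v ~ hole x → v ~ hole y → parity x ≡ parity y
  hole-neighbours-parity≡ v {x} {y} v~x v~y with anchor 4 x
  ... | b , 4+b≈x = trans (parity-cong 2∣ℓ (≈-sym 4+b≈x)) (parity-b≡y)
    where
    v~4 : v ~ hole (4 + b)
    v~4 = ~hole-resp (≈-sym 4+b≈x) v~x
    parity-b≡y : parity b ≡ parity y
    parity-b≡y with adj G v (hole (2 + b)) in v-2 | adj G v (hole (6 + b)) in v-6
    ... | true  | _     = sym (spaced-neighbours-parity b v v-2 v~4 v~y)
    ... | false | true  = sym (spaced-neighbours-parity (2 + b) v v~4 v-6 v~y)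
    ... | false | false = parity-cong 2∣ℓ (≈-sym (lonely-hole-neighbour (1 + b) v v~4 (v-2 ∷ v-6 ∷ []) v~y))

  parity-mismatch⇒≁ : ∀ v {x z} → v ~ hole x → parity z ≢ parity x → v ≁ hole z
  parity-mismatch⇒≁ v v~x z≢x = ¬~⇒≁ λ v~z → z≢x (hole-neighbours-parity≡ v v~z v~x)

  no-common-hole-neighbour : ∀ z {u v} → u ~ v → u ~ hole z → v ~ hole z → ⊥
  no-common-hole-neighbour z {u} {v} u~v u~z v~z =
    C3*-free (induced-copy G C3* (u ∷ v ∷ hole z ∷ hole (3 + z) ∷ [])
      ((u~v , u~z , misses-3 u u~z , tt) , (v~z , misses-3 v v~z , tt) , (hole-gap z 0 3 , tt) , tt))
    where
    misses-3 : ∀ w → w ~ hole z → w ≁ hole (3 + z)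
    misses-3 w w~z = parity-mismatch⇒≁ w w~z (parity-suc≢ z ∘ sym)

  no-neighbour-missing-window : ∀ b {u w} → u ~ hole (3 + b) → u ~ w →
                                Misses w b (0 ∷ 1 ∷ 2 ∷ 3 ∷ 4 ∷ 5 ∷ 6 ∷ []) → ⊥
  no-neighbour-missing-window b {u} {w} u~3 u~w (w-0 ∷ w-1 ∷ w-2 ∷ w-3 ∷ w-4 ∷ w-5 ∷ w-6 ∷ [])
    with adj G u (hole (1 + b)) in u-1 | adj G u (hole (5 + b)) in u-5
  ... | true  | _     = no-F2 b u w u-1 u~3 u~w (w-0 ∷ w-1 ∷ w-2 ∷ w-3 ∷ w-4 ∷ [])
  ... | false | true  = no-F2 (2 + b) u w u~3 u-5 u~w (w-2 ∷ w-3 ∷ w-4 ∷ w-5 ∷ w-6 ∷ [])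
  ... | false | false = no-long-claw b u w u~3 (u-1 ∷ ~⇒prev-≁ (2 + b) u u~3 ∷ ~⇒next-≁ (3 + b) u u~3 ∷ u-5 ∷ [])
                          u~w (w-1 ∷ w-2 ∷ w-3 ∷ w-4 ∷ w-5 ∷ [])

  no-five-cycle-through-4 : ∀ b {u v} → u ~ v → u ~ hole (3 + b) → v ~ hole (5 + b) →
                            Misses u b (0 ∷ 4 ∷ 5 ∷ []) → Misses v b (0 ∷ 3 ∷ 4 ∷ []) → ⊥
  no-five-cycle-through-4 b {u} {v} u~v u~3 v~5 (u-0 ∷ u-4 ∷ u-5 ∷ []) (v-0 ∷ v-3 ∷ v-4 ∷ []) =
    C5*-free (induced-copy G C5* (u ∷ hole (3 + b) ∷ hole (4 + b) ∷ hole (5 + b) ∷ v ∷ hole b ∷ [])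
      ((u~3 , u-4 , u-5 , u~v , u-0 , tt) ,
       (hole-suc (3 + b) , hole-gap b 3 5 , ≁-sym v-3 , ≁-sym (hole-gap b 0 3) , tt) ,
       (hole-suc (4 + b) , ≁-sym v-4 , ≁-sym (hole-gap b 0 4) , tt) ,
       (~-sym v~5 , ≁-sym (hole-gap b 0 5) , tt) ,
       (v-0 , tt) , tt))

  no-five-cycle-through-2 : ∀ b {u v} → u ~ v → u ~ hole (3 + b) → v ~ hole (1 + b) →
                            Misses u b (1 ∷ 2 ∷ 6 ∷ []) → Misses v b (2 ∷ 3 ∷ 6 ∷ []) → ⊥
  no-five-cycle-through-2 b {u} {v} u~v u~3 v~1 (u-1 ∷ u-2 ∷ u-6 ∷ []) (v-2 ∷ v-3 ∷ v-6 ∷ []) =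
    C5*-free (induced-copy G C5* (u ∷ hole (3 + b) ∷ hole (2 + b) ∷ hole (1 + b) ∷ v ∷ hole (6 + b) ∷ [])
      ((u~3 , u-2 , u-1 , u~v , u-6 , tt) ,
       (~-sym (hole-suc (2 + b)) , ≁-sym (hole-gap b 1 3) , ≁-sym v-3 , hole-gap b 3 6 , tt) ,
       (~-sym (hole-suc (1 + b)) , ≁-sym v-2 , hole-gap b 2 6 , tt) ,
       (~-sym v~1 , hole-gap b 1 6 , tt) ,
       (v-6 , tt) , tt))

  adjacent⇒hole-parity≢ : ∀ {u v x y} → u ~ v → u ~ hole x → v ~ hole y → parity x ≢ parity y
  adjacent⇒hole-parity≢ {u} {v} {x} {y} u~v u~x v~y x≡y with anchor 3 x
  ... | b , 3+b≈x = no-neighbour-missing-window b u~3 u~v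
        (v-even 0 refl ∷ v-1 ∷ v-even 2 refl ∷ v-shared 3 u~3 ∷ v-even 4 refl ∷ v-5 ∷ v-even 6 refl ∷ [])
    where
    u~3 : u ~ hole (3 + b)
    u~3 = ~hole-resp (≈-sym 3+b≈x) u~x
    y-odd : parity y ≡ parity (1 + b)
    y-odd = trans (sym x≡y) (parity-cong 2∣ℓ (≈-sym 3+b≈x))
    u-even : ∀ s → parity (s + b) ≡ parity b → u ≁ hole (s + b)
    u-even s s-even = parity-mismatch⇒≁ u u~3 λ s≡3 → parity-suc≢ b (trans (sym s-even) s≡3)
    v-even : ∀ s → parity (s + b) ≡ parity b → v ≁ hole (s + b)
    v-even s s-even = parity-mismatch⇒≁ v v~y λ s≡y → parity-suc≢ b (trans (sym s-even) (trans s≡y y-odd))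
    v-shared : ∀ s → u ~ hole (s + b) → v ≁ hole (s + b)
    v-shared s u~s = ¬~⇒≁ (no-common-hole-neighbour (s + b) u~v u~s)
    v-5 : v ≁ hole (5 + b)
    v-5 with adj G u (hole (5 + b)) in u-5
    ... | true  = v-shared 5 u-5
    ... | false = ¬~⇒≁ λ v~5 → no-five-cycle-through-4 b u~v u~3 v~5
                    (u-even 0 refl ∷ u-even 4 refl ∷ u-5 ∷ []) (v-even 0 refl ∷ v-shared 3 u~3 ∷ v-even 4 refl ∷ [])
    v-1 : v ≁ hole (1 + b)
    v-1 with adj G u (hole (1 + b)) in u-1
    ... | true  = v-shared 1 u-1
    ... | false = ¬~⇒≁ λ v~1 → no-five-cycle-through-2 b u~v u~3 v~1
                    (u-1 ∷ u-even 2 refl ∷ u-even 6 refl ∷ []) (v-even 2 refl ∷ v-shared 3 u~3 ∷ v-even 6 refl ∷ [])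

  SeesHole : Fin n → Set
  SeesHole u = ∃ λ x → u ~ hole x

  sees-hole? : ∀ u → Dec (SeesHole u)
  sees-hole? u = map′ (λ (i , u~i) → toℕ i , u~i) (λ (x , u~x) → x mod ℓ , ~hole-resp (≈-sym (toℕ-mod x)) u~x)
                      (any? λ i → adj G u (hole (toℕ i)) ≟ᵇ true)

  sees-hole-step : ∀ {u v} → u ~ v → SeesHole v → SeesHole u
  sees-hole-step {u} {v} u~v (x , v~x) with sees-hole? u | anchor 3 x
  ... | yes u-sees | _         = u-sees
  ... | no u-blind | b , 3+b≈x = ⊥-elim (no-neighbour-missing-window b (~hole-resp (≈-sym 3+b≈x) v~x) (~-sym u~v)
                                   (All.tabulate λ {s} _ → ¬~⇒≁ λ u~s → u-blind (s + b , u~s)))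

  every-vertex-sees-hole : Connected G → ∀ u → SeesHole u
  every-vertex-sees-hole connected u = along (connected u (hole 0)) (1 , hole-suc 0)
    where
    along : ∀ {u w} → Reachable G u w → SeesHole w → SeesHole u
    along here           w-sees = w-sees
    along (step u~v v⇝w) w-sees = sees-hole-step u~v (along v⇝w w-sees)

  bipartite : Connected G → Bipartite G
  bipartite connected = colour , proper
    where
    sees : ∀ u → SeesHole u
    sees = every-vertex-sees-hole connected
    colour : Fin n → Bool
    colour u = isOdd (parity (proj₁ (sees u)))
    proper : ∀ u v → u ~ v → ¬ colour u ≡ colour v
    proper u v u~v same-colour =
      adjacent⇒hole-parity≢ u~v (proj₂ (sees u)) (proj₂ (sees v)) (isOdd-injective same-colour)

lemma5p4 : ∀ {n : ℕ} (G : Graph n) → Reduced G → HasEvenHoleAtLeast8 G → Bipartite G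
lemma5p4 G (connected , _ , C3*-free , C5*-free , coC4*-free , _ , _ , _ , F1-free , F2-free , _ , _)
           (suc k , 8≤ℓ , 2∣ℓ , _ , f , _ , f-adj) =
  HoleNeighbourhoods.bipartite G k f f-adj 8≤ℓ 2∣ℓ C3*-free C5*-free coC4*-free F1-free F2-free connected
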